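{- Let $\Pi$ be a projective plane of order $q$ and let $Y$ be a set of $s$ points of $\Pi$ such that the number of lines of $\Pi$ disjoint from $Y$ is equal to \[ \frac{q^3+q^2+q-qs}{q+s}. \] Then $Y$ is a maximal $(s,\beta)$-arc, where $s=1+(q+1)(\beta-1)$ (i.e., $\beta=(q+s)/(q+1)$). Conversely, if $Y$ is a maximal $(s,\beta)$-arc in a projective plane of order $q$, then the number of lines disjoint from $Y$ is equal to $(q^3+q^2+q-qs)/(q+s)$.
   Context: A projective plane of order $q$ has $q^2+q+1$ points and $q^2+q+1$ lines, every line containing $q+1$ points, every point on $q+1$ lines, and any two distinct points on exactly one common line. A maximal $(s,\beta)$-arc in a projective plane of order $q$ is a set $Y$ of $s$ points such that every line meets $Y$ in either $0$ or $\beta$ points. -}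

module Defs where

open import Data.Nat using (ℕ; _+_; _*_; _^_; _≤_)
open import Data.Fin using (Fin)
open import Data.Fin.Subset using (Subset; _∈_; _∩_; ∣_∣)
open import Data.Fin.Subset.Properties using (_∈?_)
open import Data.Vec using (tabulate)
open import Data.Product using (Σ; _×_)
open import Data.Sum using (_⊎_)
open import Relation.Nullary using (¬_; does)
open import Relation.Binary.PropositionalEquality using (_≡_; _≢_)
open import Data.Nat using (_≟_)

numPts : ℕ → ℕ
numPts q = q ^ 2 + q + 1

record ProjectivePlane (q : ℕ) : Set where
  field
    line         : Fin (numPts q) → Subset (numPts q)
    lineSize     : ∀ L → ∣ line L ∣ ≡ q + 1
    linesThrough : ∀ p → ∣ tabulate (λ L → does (p ∈? line L)) ∣ ≡ q + 1
    uniqueLine   : ∀ p r → p ≢ r →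
                   Σ (Fin (numPts q)) (λ L → (p ∈ line L × r ∈ line L) ×
                     (∀ L′ → p ∈ line L′ → r ∈ line L′ → L′ ≡ L))

module _ {q : ℕ} (Π : ProjectivePlane q) where
  open ProjectivePlane Π

  meet : Subset (numPts q) → Fin (numPts q) → ℕ
  meet Y L = ∣ line L ∩ Y ∣

  disjointLines : Subset (numPts q) → ℕ
  disjointLines Y = ∣ tabulate (λ L → does (meet Y L ≟ 0)) ∣

  IsMaximalArc : Subset (numPts q) → ℕ → ℕ → Set
  IsMaximalArc Y s β = ∣ Y ∣ ≡ s × (∀ L → meet Y L ≡ 0 ⊎ meet Y L ≡ β)

-- With m_L = |L ∩ Y| and n the number of lines meeting Y, double counting gives
-- ∑ m_L = (q+1)s and ∑ m_L² = s² + qs, and since n plus the number of disjoint lines is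
-- q²+q+1, the hypothesis on disjoint lines is equivalent to (q+s)n = (q+1)²s.  AM-GM gives
-- 2(q+1)(q+s)m ≤ (q+1)²m² + (q+s)² for every m > 0; summed over the lines meeting Y the two
-- sides become equal exactly under that condition, which forces (q+1)m_L = q+s on every
-- line meeting Y.  Conversely, on an arc every m_L is 0 or β, so ∑ m_L = βn and
-- ∑ m_L² = β ∑ m_L, and eliminating β gives (q+s)n = (q+1)²s.
module Submission where

open import Defs
open import Data.Nat using (ℕ; _+_; _*_; _^_; _≤_)
open import Data.Fin.Subset using (Subset; ∣_∣)
open import Data.Product using (Σ; _×_)
open import Data.Sum using (_⊎_)
open import Relation.Binary.PropositionalEquality using (_≡_)

open import Data.Nat using (zero; suc; z≤n; ∣_-_∣)
import Data.Nat as ℕ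
open import Data.Nat.Properties hiding (_≟_)
open import Data.Nat.Tactic.RingSolver using (solve-∀)
open import Data.Fin using (Fin; zero; suc; _≟_)
open import Data.Fin.Subset using (inside; outside; _∩_)
open import Data.Fin.Subset.Properties using (_∈?_)
open import Data.Bool using (Bool; true; false; _∧_)
open import Data.Vec using ([]; _∷_; lookup; tabulate)
open import Data.Vec.Properties using (lookup-zipWith; lookup∘tabulate; lookup⇒[]=; []=⇒lookup)
open import Data.Vec.Functional using (Vector)
open import Data.Product using (_,_)
open import Data.Sum using (inj₁; inj₂; [_,_]′)
open import Function using (_∘_; id; _⇔_; mk⇔; Equivalence)
open import Relation.Nullary using (does; yes; no; contradiction)
open import Relation.Binary.PropositionalEquality
  using (refl; sym; trans; cong; cong₂; subst; subst₂; _≢_; module ≡-Reasoning)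
open import Algebra.Properties.Semiring.Sum +-*-semiring
  using (sum; sum-syntax; sum-cong-≗; sum-replicate-zero; ∑-distrib-+; ∑-comm; *-distribˡ-sum; *-distribʳ-sum)

⟦_⟧ : Bool → ℕ
⟦ true ⟧ = 1
⟦ false ⟧ = 0

⟦∧⟧ : ∀ a b → ⟦ a ∧ b ⟧ ≡ ⟦ a ⟧ * ⟦ b ⟧
⟦∧⟧ true b = sym (+-identityʳ ⟦ b ⟧)
⟦∧⟧ false b = refl

⟦⟧-idem : ∀ a → ⟦ a ⟧ * ⟦ a ⟧ ≡ ⟦ a ⟧
⟦⟧-idem true = refl
⟦⟧-idem false = refl

sign : ℕ → ℕ
sign zero = 0
sign (suc _) = 1

[≡0]+sign≡1 : ∀ m → ⟦ does (m ℕ.≟ 0) ⟧ + sign m ≡ 1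
[≡0]+sign≡1 zero = refl
[≡0]+sign≡1 (suc m) = refl

m*sign[m]≡m : ∀ m → m * sign m ≡ m
m*sign[m]≡m zero = refl
m*sign[m]≡m (suc m) = *-identityʳ (suc m)

m²+[m+k]²≡2m[m+k]+k² : ∀ m k → m * m + (m + k) * (m + k) ≡ 2 * (m * (m + k)) + k * k
m²+[m+k]²≡2m[m+k]+k² = solve-∀

m≤n⇒m²+n²≡2mn+∣m-n∣² : ∀ {m n} → m ≤ n → m * m + n * n ≡ 2 * (m * n) + ∣ m - n ∣ * ∣ m - n ∣
m≤n⇒m²+n²≡2mn+∣m-n∣² {m} m≤n with m≤n⇒∃[o]m+o≡n m≤n
... | k , refl rewrite ∣m-m+n∣≡n m k = m²+[m+k]²≡2m[m+k]+k² m k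

m²+n²≡2mn+∣m-n∣² : ∀ m n → m * m + n * n ≡ 2 * (m * n) + ∣ m - n ∣ * ∣ m - n ∣
m²+n²≡2mn+∣m-n∣² m n with ≤-total m n
... | inj₁ m≤n = m≤n⇒m²+n²≡2mn+∣m-n∣² m≤n
... | inj₂ n≤m = begin
    m * m + n * n                            ≡⟨ +-comm (m * m) (n * n) ⟩
    n * n + m * m                            ≡⟨ m≤n⇒m²+n²≡2mn+∣m-n∣² n≤m ⟩
    2 * (n * m) + ∣ n - m ∣ * ∣ n - m ∣      ≡⟨ cong₂ (λ a d → 2 * a + d * d) (*-comm n m) (∣-∣-comm n m) ⟩
    2 * (m * n) + ∣ m - n ∣ * ∣ m - n ∣      ∎
  where open ≡-Reasoning

2mn≤m²+n² : ∀ m n → 2 * (m * n) ≤ m * m + n * n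
2mn≤m²+n² m n = subst (2 * (m * n) ≤_) (sym (m²+n²≡2mn+∣m-n∣² m n)) (m≤m+n _ _)

m*m≡0⇒m≡0 : ∀ m → m * m ≡ 0 → m ≡ 0
m*m≡0⇒m≡0 zero _ = refl

2mn≡m²+n²⇒m≡n : ∀ {m n} → 2 * (m * n) ≡ m * m + n * n → m ≡ n
2mn≡m²+n²⇒m≡n {m} {n} eq = ∣m-n∣≡0⇒m≡n (m*m≡0⇒m≡0 ∣ m - n ∣ ∣m-n∣²≡0)
  where
  ∣m-n∣²≡0 : ∣ m - n ∣ * ∣ m - n ∣ ≡ 0
  ∣m-n∣²≡0 = +-cancelˡ-≡ (2 * (m * n)) _ 0
    (trans (sym (trans eq (m²+n²≡2mn+∣m-n∣² m n))) (sym (+-identityʳ (2 * (m * n)))))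

2[ak]b≡2[ab]k : ∀ a b k → 2 * (a * k * b) ≡ 2 * (a * b) * k
2[ak]b≡2[ab]k = solve-∀

[ak]²+b²≡a²k²+b²*1 : ∀ a b k → a * k * (a * k) + b * b ≡ a * a * (k * k) + b * b * 1
[ak]²+b²≡a²k²+b²*1 = solve-∀

2abk≤a²k²+b²sign[k] : ∀ a b k → 2 * (a * b) * k ≤ a * a * (k * k) + b * b * sign k
2abk≤a²k²+b²sign[k] a b zero = subst (_≤ a * a * 0 + b * b * 0) (sym (*-zeroʳ (2 * (a * b)))) z≤n
2abk≤a²k²+b²sign[k] a b k@(suc _) =
  subst₂ _≤_ (2[ak]b≡2[ab]k a b k) ([ak]²+b²≡a²k²+b²*1 a b k) (2mn≤m²+n² (a * k) b)

2abk≡a²k²+b²sign[k]⇒ : ∀ a b k → 2 * (a * b) * k ≡ a * a * (k * k) + b * b * sign k →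
                       k ≡ 0 ⊎ a * k ≡ b
2abk≡a²k²+b²sign[k]⇒ a b zero _ = inj₁ refl
2abk≡a²k²+b²sign[k]⇒ a b k@(suc _) eq = inj₂ (2mn≡m²+n²⇒m≡n
  (subst₂ _≡_ (sym (2[ak]b≡2[ab]k a b k)) (sym ([ak]²+b²≡a²k²+b²*1 a b k)) eq))

sum-mono-≤ : ∀ {n} {f g : Vector ℕ n} → (∀ i → f i ≤ g i) → sum f ≤ sum g
sum-mono-≤ {zero} _ = z≤n
sum-mono-≤ {suc n} f≤g = +-mono-≤ (f≤g zero) (sum-mono-≤ (f≤g ∘ suc))

sum-mono-≤-≡⇒≡ : ∀ {n} {f g : Vector ℕ n} → (∀ i → f i ≤ g i) → sum f ≡ sum g → ∀ i → f i ≡ g i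
sum-mono-≤-≡⇒≡ {suc n} {f} {g} f≤g eq = λ where
    zero → f₀≡g₀
    (suc i) → sum-mono-≤-≡⇒≡ (f≤g ∘ suc) (+-cancelˡ-≡ (f zero) _ _ (trans eq (cong (_+ _) (sym f₀≡g₀)))) i
  where
  g₀≤f₀ : g zero ≤ f zero
  g₀≤f₀ = +-cancelʳ-≤ (sum (f ∘ suc)) (g zero) (f zero)
    (≤-trans (+-monoʳ-≤ (g zero) (sum-mono-≤ (f≤g ∘ suc))) (≤-reflexive (sym eq)))
  f₀≡g₀ : f zero ≡ g zero
  f₀≡g₀ = ≤-antisym (f≤g zero) g₀≤f₀

∑-const-1 : ∀ n → ∑[ i < n ] 1 ≡ n
∑-const-1 zero = refl
∑-const-1 (suc n) = cong suc (∑-const-1 n)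

∑-δ : ∀ {n} (p : Fin n) (g : Vector ℕ n) → ∑[ r < n ] (⟦ does (r ≟ p) ⟧ * g r) ≡ g p
∑-δ {suc n} zero g = trans (cong (g zero + 0 +_) (sum-replicate-zero n)) (trans (+-identityʳ _) (+-identityʳ _))
∑-δ (suc p) g = ∑-δ p (g ∘ suc)

∑-double-count : ∀ {m n} (w : Fin m → Fin n → ℕ) (f : Vector ℕ m) (g : Vector ℕ n) →
                 ∑[ i < m ] (f i * ∑[ j < n ] (w i j * g j)) ≡ ∑[ j < n ] (g j * ∑[ i < m ] (w i j * f i))
∑-double-count {m} {n} w f g = begin
  ∑[ i < m ] (f i * ∑[ j < n ] (w i j * g j))     ≡⟨ sum-cong-≗ (λ i → *-distribˡ-sum {n} (f i) _) ⟩
  ∑[ i < m ] ∑[ j < n ] (f i * (w i j * g j))    ≡⟨ ∑-comm {m} {n} _ ⟩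
  ∑[ j < n ] ∑[ i < m ] (f i * (w i j * g j))    ≡⟨ sum-cong-≗ (λ j → sum-cong-≗ {m} (λ i → swap (f i) (w i j) (g j))) ⟩
  ∑[ j < n ] ∑[ i < m ] (g j * (w i j * f i))    ≡⟨ sum-cong-≗ (λ j → sym (*-distribˡ-sum {m} (g j) _)) ⟩
  ∑[ j < n ] (g j * ∑[ i < m ] (w i j * f i))     ∎
  where
  open ≡-Reasoning
  swap : ∀ x y z → x * (y * z) ≡ z * (y * x)
  swap = solve-∀

∣p∣≡∑⟦p⟧ : ∀ {n} (p : Subset n) → ∣ p ∣ ≡ ∑[ i < n ] ⟦ lookup p i ⟧
∣p∣≡∑⟦p⟧ [] = refl
∣p∣≡∑⟦p⟧ (inside ∷ p) = cong suc (∣p∣≡∑⟦p⟧ p)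
∣p∣≡∑⟦p⟧ (outside ∷ p) = ∣p∣≡∑⟦p⟧ p

does[x∈?p]≡lookup : ∀ {n} (x : Fin n) (p : Subset n) → does (x ∈? p) ≡ lookup p x
does[x∈?p]≡lookup zero (inside ∷ p) = refl
does[x∈?p]≡lookup zero (outside ∷ p) = refl
does[x∈?p]≡lookup (suc x) (_ ∷ p) = does[x∈?p]≡lookup x p

a+x≡t+b⇒[x≡t⇔a≡b] : ∀ {a b x t} → a + x ≡ t + b → (x ≡ t ⇔ a ≡ b)
a+x≡t+b⇒[x≡t⇔a≡b] {a} {b} {x} {t} eq = mk⇔
  (λ x≡t → +-cancelʳ-≡ t a b (trans (trans (cong (a +_) (sym x≡t)) eq) (+-comm t b)))
  (λ a≡b → +-cancelˡ-≡ b x t (trans (trans (cong (_+ x) (sym a≡b)) eq) (+-comm t b)))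

[q+s]n+[d[q+s]+qs]≡q³+q²+q+s[q+1]² : ∀ q s d n → d + n ≡ numPts q →
  (q + s) * n + (d * (q + s) + q * s) ≡ q ^ 3 + q ^ 2 + q + s * ((q + 1) * (q + 1))
[q+s]n+[d[q+s]+qs]≡q³+q²+q+s[q+1]² q s d n d+n≡N = begin
  (q + s) * n + (d * (q + s) + q * s)   ≡⟨ regroup q s d n ⟩
  (q + s) * (d + n) + q * s             ≡⟨ cong (λ k → (q + s) * k + q * s) d+n≡N ⟩
  (q + s) * numPts q + q * s            ≡⟨ expand q s ⟩
  q ^ 3 + q ^ 2 + q + s * ((q + 1) * (q + 1)) ∎
  where
  open ≡-Reasoning
  regroup : ∀ q s d n → (q + s) * n + (d * (q + s) + q * s) ≡ (q + s) * (d + n) + q * s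
  regroup = solve-∀
  -- The solver does not parse _^_, so the powers are written out as the products they unfold to.
  expand : ∀ q s → (q + s) * (q * (q * 1) + q + 1) + q * s ≡
                   q * (q * (q * 1)) + q * (q * 1) + q + s * ((q + 1) * (q + 1))
  expand = solve-∀

k≡0⊎k≡β⇒k≡β*sign[k] : ∀ {k β} → k ≡ 0 ⊎ k ≡ β → k ≡ β * sign k
k≡0⊎k≡β⇒k≡β*sign[k] {β = β} (inj₁ refl) = sym (*-zeroʳ β)
k≡0⊎k≡β⇒k≡β*sign[k] {β = β} (inj₂ refl) = sym (m*sign[m]≡m β)

k≡0⊎k≡β⇒k*k≡β*k : ∀ {k β} → k ≡ 0 ⊎ k ≡ β → k * k ≡ β * k
k≡0⊎k≡β⇒k*k≡β*k {β = β} (inj₁ refl) = sym (*-zeroʳ β)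
k≡0⊎k≡β⇒k*k≡β*k (inj₂ refl) = refl

module Incidence {q : ℕ} (Π : ProjectivePlane q) where
  open ProjectivePlane Π

  χ : Fin (numPts q) → Fin (numPts q) → ℕ
  χ p L = ⟦ lookup (line L) p ⟧

  ∑χ≡q+1 : ∀ p → ∑[ L < numPts q ] χ p L ≡ q + 1
  ∑χ≡q+1 p = begin
    ∑[ L < numPts q ] χ p L                     ≡⟨ sum-cong-≗ (λ L → cong ⟦_⟧ (sym (lookup-through L))) ⟩
    ∑[ L < numPts q ] ⟦ lookup through L ⟧      ≡⟨ sym (∣p∣≡∑⟦p⟧ through) ⟩
    ∣ through ∣                                 ≡⟨ linesThrough p ⟩
    q + 1                                       ∎
    where
    open ≡-Reasoning
    through : Subset (numPts q)
    through = tabulate (λ L → does (p ∈? line L))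
    lookup-through : ∀ L → lookup through L ≡ lookup (line L) p
    lookup-through L = trans (lookup∘tabulate _ L) (does[x∈?p]≡lookup p (line L))

  ∑χχ-diag : ∀ p → ∑[ L < numPts q ] (χ p L * χ p L) ≡ q + 1
  ∑χχ-diag p = trans (sum-cong-≗ (λ L → ⟦⟧-idem (lookup (line L) p))) (∑χ≡q+1 p)

  ∑χχ-off : ∀ {p r} → p ≢ r → ∑[ L < numPts q ] (χ p L * χ r L) ≡ 1
  ∑χχ-off {p} {r} p≢r with uniqueLine p r p≢r
  ... | L₀ , (p∈L₀ , r∈L₀) , unique = trans (sum-cong-≗ χχ≡δ) (∑-δ L₀ (λ _ → 1))
    where
    χχ≡δ : ∀ L → χ p L * χ r L ≡ ⟦ does (L ≟ L₀) ⟧ * 1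
    χχ≡δ L with L ≟ L₀
    ... | yes refl rewrite []=⇒lookup p∈L₀ | []=⇒lookup r∈L₀ = refl
    ... | no L≢L₀ with lookup (line L) p in p∈L | lookup (line L) r in r∈L
    ...   | true  | true  = contradiction (unique L (lookup⇒[]= p (line L) p∈L) (lookup⇒[]= r (line L) r∈L)) L≢L₀
    ...   | true  | false = refl
    ...   | false | _     = refl

  ∑χχ≡1+qδ : ∀ p r → ∑[ L < numPts q ] (χ p L * χ r L) ≡ 1 + q * ⟦ does (p ≟ r) ⟧
  ∑χχ≡1+qδ p r with p ≟ r
  ... | yes refl = trans (∑χχ-diag p) (trans (+-comm q 1) (cong suc (sym (*-identityʳ q))))
  ... | no p≢r   = trans (∑χχ-off p≢r) (cong suc (sym (*-zeroʳ q)))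

module LineIntersections {q : ℕ} (Π : ProjectivePlane q) (Y : Subset (numPts q)) where
  open ProjectivePlane Π
  open Incidence Π

  𝟙Y : Fin (numPts q) → ℕ
  𝟙Y p = ⟦ lookup Y p ⟧

  m : Fin (numPts q) → ℕ
  m = meet Π Y

  meetingLines : ℕ
  meetingLines = ∑[ L < numPts q ] sign (m L)

  m≡∑χ𝟙Y : ∀ L → m L ≡ ∑[ p < numPts q ] (χ p L * 𝟙Y p)
  m≡∑χ𝟙Y L = trans (∣p∣≡∑⟦p⟧ (line L ∩ Y)) (sum-cong-≗ (λ p →
    trans (cong ⟦_⟧ (lookup-zipWith _∧_ p (line L) Y)) (⟦∧⟧ (lookup (line L) p) (lookup Y p))))

  disjointLines≡∑[m≡0] : disjointLines Π Y ≡ ∑[ L < numPts q ] ⟦ does (m L ℕ.≟ 0) ⟧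
  disjointLines≡∑[m≡0] = trans (∣p∣≡∑⟦p⟧ (tabulate (λ L → does (m L ℕ.≟ 0))))
    (sum-cong-≗ (λ L → cong ⟦_⟧ (lookup∘tabulate (λ L → does (m L ℕ.≟ 0)) L)))

  disjoint+meeting≡numPts : disjointLines Π Y + meetingLines ≡ numPts q
  disjoint+meeting≡numPts = begin
    disjointLines Π Y + meetingLines
      ≡⟨ cong (_+ meetingLines) disjointLines≡∑[m≡0] ⟩
    ∑[ L < numPts q ] ⟦ does (m L ℕ.≟ 0) ⟧ + meetingLines
      ≡⟨ sym (∑-distrib-+ (λ L → ⟦ does (m L ℕ.≟ 0) ⟧) (sign ∘ m)) ⟩
    ∑[ L < numPts q ] (⟦ does (m L ℕ.≟ 0) ⟧ + sign (m L))
      ≡⟨ sum-cong-≗ ([≡0]+sign≡1 ∘ m) ⟩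
    ∑[ L < numPts q ] 1
      ≡⟨ ∑-const-1 (numPts q) ⟩
    numPts q ∎
    where open ≡-Reasoning

  ∑m≡[q+1]∣Y∣ : ∑[ L < numPts q ] m L ≡ (q + 1) * ∣ Y ∣
  ∑m≡[q+1]∣Y∣ = begin
    ∑[ L < numPts q ] m L                                   ≡⟨ sum-cong-≗ m≡∑χ𝟙Y ⟩
    ∑[ L < numPts q ] ∑[ p < numPts q ] (χ p L * 𝟙Y p)     ≡⟨ ∑-comm {numPts q} {numPts q} _ ⟩
    ∑[ p < numPts q ] ∑[ L < numPts q ] (χ p L * 𝟙Y p)     ≡⟨ sum-cong-≗ (λ p → sym (*-distribʳ-sum (𝟙Y p) (λ L → χ p L))) ⟩
    ∑[ p < numPts q ] (∑[ L < numPts q ] χ p L * 𝟙Y p)     ≡⟨ sum-cong-≗ (λ p → cong (_* 𝟙Y p) (∑χ≡q+1 p)) ⟩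
    ∑[ p < numPts q ] ((q + 1) * 𝟙Y p)                      ≡⟨ sym (*-distribˡ-sum (q + 1) 𝟙Y) ⟩
    (q + 1) * ∑[ p < numPts q ] 𝟙Y p                        ≡⟨ cong ((q + 1) *_) (sym (∣p∣≡∑⟦p⟧ Y)) ⟩
    (q + 1) * ∣ Y ∣                                         ∎
    where open ≡-Reasoning

  ∑χm≡∣Y∣+q𝟙Y : ∀ p → ∑[ L < numPts q ] (χ p L * m L) ≡ ∣ Y ∣ + q * 𝟙Y p
  ∑χm≡∣Y∣+q𝟙Y p = begin
    ∑[ L < numPts q ] (χ p L * m L)
      ≡⟨ sum-cong-≗ (λ L → cong (χ p L *_) (m≡∑χ𝟙Y L)) ⟩
    ∑[ L < numPts q ] (χ p L * ∑[ r < numPts q ] (χ r L * 𝟙Y r))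
      ≡⟨ ∑-double-count (λ L r → χ r L) (χ p) 𝟙Y ⟩
    ∑[ r < numPts q ] (𝟙Y r * ∑[ L < numPts q ] (χ r L * χ p L))
      ≡⟨ sum-cong-≗ (λ r → cong (𝟙Y r *_) (∑χχ≡1+qδ r p)) ⟩
    ∑[ r < numPts q ] (𝟙Y r * (1 + q * ⟦ does (r ≟ p) ⟧))
      ≡⟨ sum-cong-≗ (λ r → distribute (𝟙Y r) q ⟦ does (r ≟ p) ⟧) ⟩
    ∑[ r < numPts q ] (𝟙Y r + q * (⟦ does (r ≟ p) ⟧ * 𝟙Y r))
      ≡⟨ ∑-distrib-+ {numPts q} 𝟙Y _ ⟩
    ∑[ r < numPts q ] 𝟙Y r + ∑[ r < numPts q ] (q * (⟦ does (r ≟ p) ⟧ * 𝟙Y r))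
      ≡⟨ cong₂ _+_ (sym (∣p∣≡∑⟦p⟧ Y)) (sym (*-distribˡ-sum q (λ r → ⟦ does (r ≟ p) ⟧ * 𝟙Y r))) ⟩
    ∣ Y ∣ + q * ∑[ r < numPts q ] (⟦ does (r ≟ p) ⟧ * 𝟙Y r)
      ≡⟨ cong (λ k → ∣ Y ∣ + q * k) (∑-δ p 𝟙Y) ⟩
    ∣ Y ∣ + q * 𝟙Y p ∎
    where
    open ≡-Reasoning
    distribute : ∀ y q d → y * (1 + q * d) ≡ y + q * (d * y)
    distribute = solve-∀

  ∑m²≡∣Y∣²+q∣Y∣ : ∑[ L < numPts q ] (m L * m L) ≡ ∣ Y ∣ * ∣ Y ∣ + q * ∣ Y ∣
  ∑m²≡∣Y∣²+q∣Y∣ = begin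
    ∑[ L < numPts q ] (m L * m L)
      ≡⟨ sum-cong-≗ (λ L → cong (m L *_) (m≡∑χ𝟙Y L)) ⟩
    ∑[ L < numPts q ] (m L * ∑[ p < numPts q ] (χ p L * 𝟙Y p))
      ≡⟨ ∑-double-count (λ L p → χ p L) m 𝟙Y ⟩
    ∑[ p < numPts q ] (𝟙Y p * ∑[ L < numPts q ] (χ p L * m L))
      ≡⟨ sum-cong-≗ (λ p → cong (𝟙Y p *_) (∑χm≡∣Y∣+q𝟙Y p)) ⟩
    ∑[ p < numPts q ] (𝟙Y p * (∣ Y ∣ + q * 𝟙Y p))
      ≡⟨ sum-cong-≗ (λ p → distribute (lookup Y p)) ⟩
    ∑[ p < numPts q ] (∣ Y ∣ * 𝟙Y p + q * 𝟙Y p)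
      ≡⟨ ∑-distrib-+ {numPts q} _ _ ⟩
    ∑[ p < numPts q ] (∣ Y ∣ * 𝟙Y p) + ∑[ p < numPts q ] (q * 𝟙Y p)
      ≡⟨ cong₂ _+_ (sym (*-distribˡ-sum ∣ Y ∣ 𝟙Y)) (sym (*-distribˡ-sum q 𝟙Y)) ⟩
    ∣ Y ∣ * ∑[ p < numPts q ] 𝟙Y p + q * ∑[ p < numPts q ] 𝟙Y p
      ≡⟨ cong (λ k → ∣ Y ∣ * k + q * k) (sym (∣p∣≡∑⟦p⟧ Y)) ⟩
    ∣ Y ∣ * ∣ Y ∣ + q * ∣ Y ∣ ∎
    where
    open ≡-Reasoning
    distribute : ∀ b → ⟦ b ⟧ * (∣ Y ∣ + q * ⟦ b ⟧) ≡ ∣ Y ∣ * ⟦ b ⟧ + q * ⟦ b ⟧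
    distribute true = trans (+-identityʳ _) (cong (_+ q * 1) (sym (*-identityʳ ∣ Y ∣)))
    distribute false = sym (cong₂ _+_ (*-zeroʳ ∣ Y ∣) (*-zeroʳ q))

  disjointCount⇔tight : disjointLines Π Y * (q + ∣ Y ∣) + q * ∣ Y ∣ ≡ q ^ 3 + q ^ 2 + q
                        ⇔ (q + ∣ Y ∣) * meetingLines ≡ ∣ Y ∣ * ((q + 1) * (q + 1))
  disjointCount⇔tight = a+x≡t+b⇒[x≡t⇔a≡b]
    ([q+s]n+[d[q+s]+qs]≡q³+q²+q+s[q+1]² q ∣ Y ∣ (disjointLines Π Y) meetingLines disjoint+meeting≡numPts)

  tight⇒arc : (q + ∣ Y ∣) * meetingLines ≡ ∣ Y ∣ * ((q + 1) * (q + 1)) →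
              ∀ L → m L ≡ 0 ⊎ (q + 1) * m L ≡ q + ∣ Y ∣
  tight⇒arc tight L = 2abk≡a²k²+b²sign[k]⇒ a b (m L) (sum-mono-≤-≡⇒≡ (λ L → 2abk≤a²k²+b²sign[k] a b (m L)) sums L)
    where
    open ≡-Reasoning
    a b : ℕ
    a = q + 1
    b = q + ∣ Y ∣
    balance : ∀ q s → 2 * ((q + 1) * (q + s)) * ((q + 1) * s) ≡
                      (q + 1) * (q + 1) * (s * s + q * s) + (q + s) * (s * ((q + 1) * (q + 1)))
    balance = solve-∀
    sums : ∑[ L < numPts q ] (2 * (a * b) * m L) ≡ ∑[ L < numPts q ] (a * a * (m L * m L) + b * b * sign (m L))
    sums = begin
      ∑[ L < numPts q ] (2 * (a * b) * m L)
        ≡⟨ sym (*-distribˡ-sum (2 * (a * b)) m) ⟩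
      2 * (a * b) * ∑[ L < numPts q ] m L
        ≡⟨ cong (2 * (a * b) *_) ∑m≡[q+1]∣Y∣ ⟩
      2 * (a * b) * (a * ∣ Y ∣)
        ≡⟨ balance q ∣ Y ∣ ⟩
      a * a * (∣ Y ∣ * ∣ Y ∣ + q * ∣ Y ∣) + b * (∣ Y ∣ * (a * a))
        ≡⟨ cong₂ _+_ (cong (a * a *_) (sym ∑m²≡∣Y∣²+q∣Y∣)) (trans (cong (b *_) (sym tight)) (sym (*-assoc b b meetingLines))) ⟩
      a * a * ∑[ L < numPts q ] (m L * m L) + b * b * meetingLines
        ≡⟨ cong₂ _+_ (*-distribˡ-sum (a * a) (λ L → m L * m L)) (*-distribˡ-sum (b * b) (sign ∘ m)) ⟩
      ∑[ L < numPts q ] (a * a * (m L * m L)) + ∑[ L < numPts q ] (b * b * sign (m L))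
        ≡⟨ sym (∑-distrib-+ {numPts q} _ _) ⟩
      ∑[ L < numPts q ] (a * a * (m L * m L) + b * b * sign (m L)) ∎

  module _ {β : ℕ} (arc : ∀ L → m L ≡ 0 ⊎ m L ≡ β) where
    open ≡-Reasoning

    [q+1]∣Y∣≡β*meetingLines : (q + 1) * ∣ Y ∣ ≡ β * meetingLines
    [q+1]∣Y∣≡β*meetingLines = begin
      (q + 1) * ∣ Y ∣                                ≡⟨ sym ∑m≡[q+1]∣Y∣ ⟩
      ∑[ L < numPts q ] m L                          ≡⟨ sum-cong-≗ (k≡0⊎k≡β⇒k≡β*sign[k] ∘ arc) ⟩
      ∑[ L < numPts q ] (β * sign (m L))             ≡⟨ sym (*-distribˡ-sum β (sign ∘ m)) ⟩
      β * meetingLines                               ∎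

    ∣Y∣²+q∣Y∣≡β[q+1]∣Y∣ : ∣ Y ∣ * ∣ Y ∣ + q * ∣ Y ∣ ≡ β * ((q + 1) * ∣ Y ∣)
    ∣Y∣²+q∣Y∣≡β[q+1]∣Y∣ = begin
      ∣ Y ∣ * ∣ Y ∣ + q * ∣ Y ∣                      ≡⟨ sym ∑m²≡∣Y∣²+q∣Y∣ ⟩
      ∑[ L < numPts q ] (m L * m L)                  ≡⟨ sum-cong-≗ (k≡0⊎k≡β⇒k*k≡β*k ∘ arc) ⟩
      ∑[ L < numPts q ] (β * m L)                    ≡⟨ sym (*-distribˡ-sum β m) ⟩
      β * ∑[ L < numPts q ] m L                      ≡⟨ cong (β *_) ∑m≡[q+1]∣Y∣ ⟩
      β * ((q + 1) * ∣ Y ∣)                          ∎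

  arc⇒tight : ∀ β → (∀ L → m L ≡ 0 ⊎ m L ≡ β) → (q + ∣ Y ∣) * meetingLines ≡ ∣ Y ∣ * ((q + 1) * (q + 1))
  arc⇒tight zero arc = begin
    (q + ∣ Y ∣) * meetingLines                       ≡⟨ cong ((q + ∣ Y ∣) *_) meetingLines≡0 ⟩
    (q + ∣ Y ∣) * 0                                  ≡⟨ *-zeroʳ (q + ∣ Y ∣) ⟩
    0                                                ≡⟨ cong (_* ((q + 1) * (q + 1))) (sym ∣Y∣≡0) ⟩
    ∣ Y ∣ * ((q + 1) * (q + 1))                      ∎
    where
    open ≡-Reasoning
    meetingLines≡0 : meetingLines ≡ 0
    meetingLines≡0 = trans (sum-cong-≗ (λ L → cong sign ([ id , id ]′ (arc L)))) (sum-replicate-zero (numPts q))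
    ∣Y∣≡0 : ∣ Y ∣ ≡ 0
    ∣Y∣≡0 = [ (λ q+1≡0 → contradiction q+1≡0 (m+1+n≢0 q)) , id ]′
              (m*n≡0⇒m≡0∨n≡0 (q + 1) ([q+1]∣Y∣≡β*meetingLines arc))
  arc⇒tight β@(suc _) arc = *-cancelˡ-≡ _ _ β (begin
    β * ((q + ∣ Y ∣) * meetingLines)                 ≡⟨ x[yz]≡y[xz] β (q + ∣ Y ∣) meetingLines ⟩
    (q + ∣ Y ∣) * (β * meetingLines)                 ≡⟨ cong ((q + ∣ Y ∣) *_) (sym ([q+1]∣Y∣≡β*meetingLines arc)) ⟩
    (q + ∣ Y ∣) * ((q + 1) * ∣ Y ∣)                  ≡⟨ regroup q ∣ Y ∣ ⟩
    (q + 1) * (∣ Y ∣ * ∣ Y ∣ + q * ∣ Y ∣)            ≡⟨ cong ((q + 1) *_) (∣Y∣²+q∣Y∣≡β[q+1]∣Y∣ arc) ⟩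
    (q + 1) * (β * ((q + 1) * ∣ Y ∣))                ≡⟨ regroup′ q β ∣ Y ∣ ⟩
    β * (∣ Y ∣ * ((q + 1) * (q + 1)))                ∎)
    where
    open ≡-Reasoning
    x[yz]≡y[xz] : ∀ x y z → x * (y * z) ≡ y * (x * z)
    x[yz]≡y[xz] = solve-∀
    regroup : ∀ q s → (q + s) * ((q + 1) * s) ≡ (q + 1) * (s * s + q * s)
    regroup = solve-∀
    regroup′ : ∀ q β s → (q + 1) * (β * ((q + 1) * s)) ≡ β * (s * ((q + 1) * (q + 1)))
    regroup′ = solve-∀

corollary4 : (q : ℕ) → 2 ≤ q → (Π : ProjectivePlane q) → (Y : Subset (numPts q)) → (s : ℕ) → ∣ Y ∣ ≡ s →
    ((disjointLines Π Y * (q + s) + q * s ≡ q ^ 3 + q ^ 2 + q) →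
      (∀ L → meet Π Y L ≡ 0 ⊎ (q + 1) * meet Π Y L ≡ q + s))
    × ((Σ ℕ (λ β → IsMaximalArc Π Y s β)) →
      disjointLines Π Y * (q + s) + q * s ≡ q ^ 3 + q ^ 2 + q)
corollary4 q _ Π Y .(∣ Y ∣) refl =
    (λ count → tight⇒arc (Equivalence.to disjointCount⇔tight count))
  , (λ where (β , _ , arc) → Equivalence.from disjointCount⇔tight (arc⇒tight β arc))
  where open LineIntersections Π Y
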